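{- Let $X$ be a finite set and $f\in\mathrm{Bool}(X)$ be rigid. Then $\mathcal{E}^W(f)=\mathcal{E}^S(f)$.
   Context: A boolean function on a finite set $X$ is a map $f:\mathcal{P}(X)\to\mathbb{Z}$ with $f(\emptyset)=0$; $\mathrm{Bool}(X)$ is the set of them. $f_{\mid Y}$ is restriction to $\mathcal{P}(Y)$; for disjoint $X,Y$, $f\star_1 g(A)=f(A\cap X)+g(A\cap Y)$. For nonempty $X$, $f$ is indecomposable if $f=f'\star_1f''$ with $f'\in\mathrm{Bool}(X\setminus Y)$, $f''\in\mathrm{Bool}(Y)$ forces $Y\in\{\emptyset,X\}$. $\sim_f^i$ is the unique equivalence on $X$ such that $f$ is the $\star_1$-product of the $f_{\mid Y}$ over its classes (the indecomposable components), each indecomposable; $\mathrm{ic}(f)$ is the number of its classes ($0$ if $X=\emptyset$). For an equivalence $\sim$ on $X$ ($\varpi_\sim$ the projection, $\mathrm{cl}(\sim)$ its number of classes): $f/{\sim}(A)=f(\varpi_\sim^{ -1}(A))$ for $A\subseteq X/{\sim}$, and $f\mid\sim(A)=\sum_{Y\in X/\sim}f(A\cap Y)$. $\mathcal{E}^W(f)=\{\sim:\mathrm{ic}(f\mid\sim)=\mathrm{cl}(\sim)\}$, $\mathcal{E}^S(f)=\{\sim\in\mathcal{E}^W(f):\mathrm{ic}(f/{\sim})=\mathrm{ic}(f)\}$. An indecomposable $f$ is rigid if for all disjoint $A,B\subseteq X$ with $f(A\sqcup B)=f(A)+f(B)$, one has $f(A'\sqcup B')=f(A')+f(B')$ for all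 $A'\subseteq A$, $B'\subseteq B$. A general $f$ is rigid if its restriction to each indecomposable component is rigid. -}

module Defs where

open import Data.Nat using (ℕ)
open import Data.Integer using (ℤ; _+_) renaming (0ℤ to 0ℤ)
open import Data.Fin using (Fin; zero; suc; _≟_)
open import Data.Fin.Subset using (Subset; ⊥; _∩_; _∪_; _─_; _⊆_; Nonempty)
open import Data.Vec using (tabulate; lookup)
open import Data.Product using (Σ; ∃; _×_; _,_)
open import Data.Sum using (_⊎_)
open import Relation.Binary.PropositionalEquality using (_≡_)
open import Relation.Nullary.Decidable using (⌊_⌋)
open import Function.Definitions using (Surjective)

-- A (not yet normalised) set function on X; membership in Bool(X)
-- additionally requires f ∅ = 0 (imposed separately as a hypothesis).
SetFun : ℕ → Set
SetFun n = Subset n → ℤ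

sumFin : ∀ {k} → (Fin k → ℤ) → ℤ
sumFin {ℕ.zero}  g = 0ℤ
sumFin {ℕ.suc k} g = g zero + sumFin (λ i → g (suc i))

-- An equivalence relation ~ on Fin n with k classes is encoded by a
-- surjective class map  p : Fin n → Fin k  (its projection ϖ_~, with X/~ = Fin k).
SurjectiveMap : ∀ {n k} → (Fin n → Fin k) → Set
SurjectiveMap p = Surjective _≡_ _≡_ p

cls : ∀ {n k} → (Fin n → Fin k) → Fin k → Subset n
cls p c = tabulate (λ i → ⌊ p i ≟ c ⌋)

preimage : ∀ {n k} → (Fin n → Fin k) → Subset k → Subset n
preimage p A = tabulate (λ i → lookup A (p i))

quot : ∀ {n k} → SetFun n → (Fin n → Fin k) → SetFun k
quot f p A = f (preimage p A)

restr : ∀ {n k} → SetFun n → (Fin n → Fin k) → SetFun n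
restr f p A = sumFin (λ c → f (A ∩ cls p c))

-- The restriction f_{|Y} (Y ⊆ X) is indecomposable: Y nonempty, and whenever
-- f_{|Y} = f' ⋆₁ f'' with f' ∈ Bool(Y ∖ Z), f'' ∈ Bool(Z), Z ⊆ Y, then Z ∈ {∅, Y}.
-- (f', f'' are given as functions on all subsets of X; only their values on
-- subsets of Y∖Z resp. Z are used.)
IndecOn : ∀ {n} → SetFun n → Subset n → Set
IndecOn {n} f Y =
  Nonempty Y ×
  ((Z : Subset n) → Z ⊆ Y →
   (f' f'' : SetFun n) → f' ⊥ ≡ 0ℤ → f'' ⊥ ≡ 0ℤ →
   ((A : Subset n) → A ⊆ Y → f A ≡ f' (A ∩ (Y ─ Z)) + f'' (A ∩ Z)) →
   Z ≡ ⊥ ⊎ Z ≡ Y)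

IsICDecomp : ∀ {n m} → SetFun n → (Fin n → Fin m) → Set
IsICDecomp {n} g q =
  SurjectiveMap q ×
  ((A : Subset n) → g A ≡ sumFin (λ c → g (A ∩ cls q c))) ×
  ((c : _) → IndecOn g (cls q c))

HasIC : ∀ {n} → SetFun n → ℕ → Set
HasIC {n} g m = Σ (Fin n → Fin m) (λ q → IsICDecomp g q)

RigidOn : ∀ {n} → SetFun n → Subset n → Set
RigidOn {n} f Y =
  (A B : Subset n) → A ⊆ Y → B ⊆ Y → A ∩ B ≡ ⊥ →
  f (A ∪ B) ≡ f A + f B →
  (A' B' : Subset n) → A' ⊆ A → B' ⊆ B →
  f (A' ∪ B') ≡ f A' + f B'

Rigid : ∀ {n} → SetFun n → Set
Rigid {n} f =
  Σ ℕ λ m → Σ (Fin n → Fin m) λ q → IsICDecomp f q × ((c : Fin m) → RigidOn f (cls q c))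

InEW : ∀ {n k} → SetFun n → (Fin n → Fin k) → Set
InEW {k = k} f p = SurjectiveMap p × HasIC (restr f p) k

InES : ∀ {n k} → SetFun n → (Fin n → Fin k) → Set
InES {n} {k} f p = InEW f p × ((m m' : ℕ) → HasIC (quot f p) m → HasIC f m' → m ≡ m')

{-# OPTIONS --safe #-}
-- For ~ ∈ E^W(f), the k indecomposable components of f|~ refine the k classes of ~, hence
-- coincide with them; as f|~ agrees with f inside a class, every class is indecomposable for f.
-- An indecomposable set lies inside a single block of any ⋆₁-decomposition, so each component
-- of f is a union of classes and its image in X/~ is a block of a decomposition of f/~.
-- Rigidity makes these images indecomposable, so f/~ has as many components as f; the number of
-- components is well defined, again because indecomposable sets lie inside blocks.
module Submission where

open import Defs
open import Data.Nat using (ℕ; zero; suc)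
open import Data.Nat.Properties using (1+n≰n)
open import Data.Integer using (ℤ; 0ℤ; _+_)
open import Data.Integer.Properties using (+-identityˡ; +-identityʳ; +-comm; +-assoc)
open import Data.Bool using (Bool; true; false)
open import Data.Bool.Properties using (T-≡)
open import Data.Fin using (Fin; zero; suc; _≟_; punchOut)
open import Data.Fin.Properties
  using (suc-injective; punchOut-injective; injective⇒≤; cantor-schröder-bernstein)
open import Data.Fin.Subset using (Subset; ⊥; _∩_; _∪_; _─_; _⊆_; _∈_; _∉_)
open import Data.Fin.Subset.Properties
  using ( ⊆-refl; ⊆-reflexive; ⊆-antisym; ∉⊥; Empty-unique; drop-there
        ; p∩q⊆p; p∩q⊆q; x∈p∩q⁺; x∈p∩q⁻; x∈p∪q⁺; x∈p∪q⁻; ∩-assoc; ∩-comm; ∩-zeroˡ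
        ; p─q⊆p; x∈p∧x∉q⇒x∈p─q; _∈?_)
open import Data.Vec using (_∷_; here; there; tabulate)
open import Data.Vec.Properties using (lookup∘tabulate; tabulate-cong; []=⇒lookup; lookup⇒[]=)
open import Data.Product using (Σ; ∃; _×_; _,_; proj₁; proj₂)
open import Data.Sum as Sum using (_⊎_; inj₁; inj₂)
open import Function.Base using (_∘_)
open import Function.Bundles using (_⇔_; mk⇔; Equivalence)
open import Function.Definitions using (Injective; StrictlySurjective)
open import Function.Consequences.Propositional
  using (surjective⇒strictlySurjective; strictlySurjective⇒surjective)
open import Relation.Binary.PropositionalEquality
open import Relation.Nullary using (yes; no; contradiction)
open import Relation.Nullary.Decidable using (⌊_⌋; toWitness; fromWitness)

private variable
  n k m m₁ m₂ : ℕ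

x∈p─q⁻ : (p q : Subset n) {x : Fin n} → x ∈ p ─ q → x ∈ p × x ∉ q
x∈p─q⁻ (true  ∷ p) (false ∷ q) here = here , λ ()
x∈p─q⁻ (false ∷ p) (false ∷ q) {zero} ()
x∈p─q⁻ (s     ∷ p) (true  ∷ q) {zero} ()
x∈p─q⁻ (s     ∷ p) (t     ∷ q) (there x∈p─q) with x∈p─q⁻ p q x∈p─q
... | x∈p , x∉q = there x∈p , x∉q ∘ drop-there

─-monoˡ : {A B : Subset n} (S : Subset n) → A ⊆ B → A ─ S ⊆ B ─ S
─-monoˡ {A = A} S A⊆B x∈A─S with x∈p─q⁻ A S x∈A─S
... | x∈A , x∉S = x∈p∧x∉q⇒x∈p─q (A⊆B x∈A) x∉S

∩-monoˡ : {A B : Subset n} (S : Subset n) → A ⊆ B → A ∩ S ⊆ B ∩ S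
∩-monoˡ {A = A} S A⊆B x∈A∩S with x∈p∩q⁻ A S x∈A∩S
... | x∈A , x∈S = x∈p∩q⁺ (A⊆B x∈A , x∈S)

⊆⇒∩≡ : {A B : Subset n} → A ⊆ B → A ∩ B ≡ A
⊆⇒∩≡ {A = A} {B} A⊆B = ⊆-antisym (p∩q⊆p A B) (λ x∈A → x∈p∩q⁺ (x∈A , A⊆B x∈A))

⊆⇒∩─≡─ : {A C : Subset n} (S : Subset n) → A ⊆ C → A ∩ (C ─ S) ≡ A ─ S
⊆⇒∩─≡─ {A = A} {C} S A⊆C = ⊆-antisym to from
  where
  to : A ∩ (C ─ S) ⊆ A ─ S
  to x∈ with x∈p∩q⁻ A (C ─ S) x∈
  ... | x∈A , x∈C─S = x∈p∧x∉q⇒x∈p─q x∈A (proj₂ (x∈p─q⁻ C S x∈C─S))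
  from : A ─ S ⊆ A ∩ (C ─ S)
  from x∈A─S = x∈p∩q⁺ (p─q⊆p A S x∈A─S , ─-monoˡ S A⊆C x∈A─S)

⊆⇒─∩≡─ : {A C : Subset n} (S : Subset n) → A ⊆ C → A ─ (C ∩ S) ≡ A ─ S
⊆⇒─∩≡─ {A = A} {C} S A⊆C = ⊆-antisym to from
  where
  to : A ─ (C ∩ S) ⊆ A ─ S
  to x∈ with x∈p─q⁻ A (C ∩ S) x∈
  ... | x∈A , x∉C∩S = x∈p∧x∉q⇒x∈p─q x∈A (λ x∈S → x∉C∩S (x∈p∩q⁺ (A⊆C x∈A , x∈S)))
  from : A ─ S ⊆ A ─ (C ∩ S)
  from x∈ with x∈p─q⁻ A S x∈
  ... | x∈A , x∉S = x∈p∧x∉q⇒x∈p─q x∈A (x∉S ∘ p∩q⊆q C S)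

─∪∩≡ : (A S : Subset n) → (A ─ S) ∪ (A ∩ S) ≡ A
─∪∩≡ A S = ⊆-antisym to from
  where
  to : (A ─ S) ∪ (A ∩ S) ⊆ A
  to x∈ = Sum.[ p─q⊆p A S , p∩q⊆p A S ] (x∈p∪q⁻ (A ─ S) (A ∩ S) x∈)
  from : A ⊆ (A ─ S) ∪ (A ∩ S)
  from {x} x∈A with x ∈? S
  ... | yes x∈S = x∈p∪q⁺ (inj₂ (x∈p∩q⁺ (x∈A , x∈S)))
  ... | no x∉S  = x∈p∪q⁺ (inj₁ (x∈p∧x∉q⇒x∈p─q x∈A x∉S))

disjoint⇒∩≡⊥ : {A B : Subset n} → (∀ {x} → x ∈ A → x ∉ B) → A ∩ B ≡ ⊥
disjoint⇒∩≡⊥ {A = A} {B} disjoint =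
  Empty-unique λ (x , x∈A∩B) → let (x∈A , x∈B) = x∈p∩q⁻ A B x∈A∩B in disjoint x∈A x∈B

─∩≡∩ : {S T : Subset n} (A : Subset n) → (∀ {x} → x ∈ S → x ∉ T) → (A ─ T) ∩ S ≡ A ∩ S
─∩≡∩ {S = S} {T} A disjoint = ⊆-antisym (∩-monoˡ S (p─q⊆p A T)) from
  where
  from : A ∩ S ⊆ (A ─ T) ∩ S
  from x∈ with x∈p∩q⁻ A S x∈
  ... | x∈A , x∈S = x∈p∩q⁺ (x∈p∧x∉q⇒x∈p─q x∈A (disjoint x∈S) , x∈S)

∈-tabulate⁻ : {f : Fin n → Bool} {x : Fin n} → x ∈ tabulate f → f x ≡ true
∈-tabulate⁻ {f = f} {x} x∈ = trans (sym (lookup∘tabulate f x)) ([]=⇒lookup x∈)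

∈-tabulate⁺ : {f : Fin n → Bool} {x : Fin n} → f x ≡ true → x ∈ tabulate f
∈-tabulate⁺ {f = f} {x} fx≡true = lookup⇒[]= x (tabulate f) (trans (lookup∘tabulate f x) fx≡true)

∈cls⁻ : {q : Fin n → Fin k} {c : Fin k} {x : Fin n} → x ∈ cls q c → q x ≡ c
∈cls⁻ x∈ = toWitness (Equivalence.from T-≡ (∈-tabulate⁻ x∈))

∈cls⁺ : {q : Fin n → Fin k} {c : Fin k} {x : Fin n} → q x ≡ c → x ∈ cls q c
∈cls⁺ qx≡c = ∈-tabulate⁺ (Equivalence.to T-≡ (fromWitness qx≡c))

cls-disjoint : {q : Fin n → Fin k} {c d : Fin k} {x : Fin n} → c ≢ d → x ∈ cls q c → x ∉ cls q d
cls-disjoint c≢d x∈c x∈d = c≢d (trans (sym (∈cls⁻ x∈c)) (∈cls⁻ x∈d))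

∈preimage⁻ : (p : Fin n → Fin k) (A : Subset k) {x : Fin n} → x ∈ preimage p A → p x ∈ A
∈preimage⁻ p A {x} x∈ = lookup⇒[]= (p x) A (∈-tabulate⁻ x∈)

∈preimage⁺ : (p : Fin n → Fin k) {A : Subset k} {x : Fin n} → p x ∈ A → x ∈ preimage p A
∈preimage⁺ p px∈A = ∈-tabulate⁺ ([]=⇒lookup px∈A)

preimage-∩ : (p : Fin n → Fin k) (A B : Subset k) → preimage p (A ∩ B) ≡ preimage p A ∩ preimage p B
preimage-∩ p A B = ⊆-antisym to from
  where
  to : preimage p (A ∩ B) ⊆ preimage p A ∩ preimage p B
  to x∈ with x∈p∩q⁻ A B (∈preimage⁻ p (A ∩ B) x∈)
  ... | px∈A , px∈B = x∈p∩q⁺ (∈preimage⁺ p px∈A , ∈preimage⁺ p px∈B)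
  from : preimage p A ∩ preimage p B ⊆ preimage p (A ∩ B)
  from x∈ with x∈p∩q⁻ (preimage p A) (preimage p B) x∈
  ... | x∈pA , x∈pB = ∈preimage⁺ p (x∈p∩q⁺ (∈preimage⁻ p A x∈pA , ∈preimage⁻ p B x∈pB))

preimage-─ : (p : Fin n → Fin k) (A B : Subset k) → preimage p (A ─ B) ≡ preimage p A ─ preimage p B
preimage-─ p A B = ⊆-antisym to from
  where
  to : preimage p (A ─ B) ⊆ preimage p A ─ preimage p B
  to x∈ with x∈p─q⁻ A B (∈preimage⁻ p (A ─ B) x∈)
  ... | px∈A , px∉B = x∈p∧x∉q⇒x∈p─q (∈preimage⁺ p px∈A) (px∉B ∘ ∈preimage⁻ p B)
  from : preimage p A ─ preimage p B ⊆ preimage p (A ─ B)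
  from x∈ with x∈p─q⁻ (preimage p A) (preimage p B) x∈
  ... | x∈pA , x∉pB = ∈preimage⁺ p (x∈p∧x∉q⇒x∈p─q (∈preimage⁻ p A x∈pA) (x∉pB ∘ ∈preimage⁺ p))

preimage-⊥ : (p : Fin n → Fin k) → preimage p ⊥ ≡ ⊥
preimage-⊥ p = Empty-unique λ (_ , x∈) → ∉⊥ (∈preimage⁻ p ⊥ x∈)

preimage-cls : (p : Fin n → Fin k) (r : Fin k → Fin m) {q : Fin n → Fin m} →
  (∀ x → q x ≡ r (p x)) → (d : Fin m) → preimage p (cls r d) ≡ cls q d
preimage-cls p r q≗r∘p d =
  tabulate-cong λ i → trans (lookup∘tabulate (λ c → ⌊ r c ≟ d ⌋) (p i)) (cong (λ c → ⌊ c ≟ d ⌋) (sym (q≗r∘p i)))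

preimage-mono : (p : Fin n → Fin k) {A B : Subset k} → A ⊆ B → preimage p A ⊆ preimage p B
preimage-mono p {A} A⊆B = ∈preimage⁺ p ∘ A⊆B ∘ ∈preimage⁻ p A

preimage-reflects-⊆ : {p : Fin n → Fin k} → SurjectiveMap p → {A B : Subset k} →
  preimage p A ⊆ preimage p B → A ⊆ B
preimage-reflects-⊆ {p = p} surj {B = B} pA⊆pB {c} c∈A with surjective⇒strictlySurjective surj c
... | x , refl = ∈preimage⁻ p B (pA⊆pB (∈preimage⁺ p c∈A))

preimage-injective : {p : Fin n → Fin k} → SurjectiveMap p → {A B : Subset k} →
  preimage p A ≡ preimage p B → A ≡ B
preimage-injective surj pA≡pB =
  ⊆-antisym (preimage-reflects-⊆ surj (⊆-reflexive pA≡pB)) (preimage-reflects-⊆ surj (⊆-reflexive (sym pA≡pB)))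

sumFin-cong : {g h : Fin k → ℤ} → (∀ c → g c ≡ h c) → sumFin g ≡ sumFin h
sumFin-cong {k = zero}  g≗h = refl
sumFin-cong {k = suc k} g≗h = cong₂ _+_ (g≗h zero) (sumFin-cong (g≗h ∘ suc))

sumFin-zero : {g : Fin k → ℤ} → (∀ c → g c ≡ 0ℤ) → sumFin g ≡ 0ℤ
sumFin-zero {k = zero}  g≗0 = refl
sumFin-zero {k = suc k} g≗0 = cong₂ _+_ (g≗0 zero) (sumFin-zero (g≗0 ∘ suc))

sumFin-split : (d : Fin k) (g h : Fin k → ℤ) → h d ≡ 0ℤ → (∀ c → c ≢ d → h c ≡ g c) →
  sumFin g ≡ g d + sumFin h
sumFin-split zero g h hd≡0 h≗g = cong (g zero +_) (begin
  sumFin (g ∘ suc)         ≡⟨ sumFin-cong (λ c → sym (h≗g (suc c) λ ())) ⟩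
  sumFin (h ∘ suc)         ≡⟨ sym (+-identityˡ _) ⟩
  0ℤ + sumFin (h ∘ suc)    ≡⟨ cong (_+ sumFin (h ∘ suc)) (sym hd≡0) ⟩
  sumFin h                 ∎)
  where open ≡-Reasoning
sumFin-split (suc d) g h hd≡0 h≗g = begin
  g zero + sumFin (g ∘ suc)                ≡⟨ cong (g zero +_) (sumFin-split d (g ∘ suc) (h ∘ suc) hd≡0
                                                 λ c c≢d → h≗g (suc c) (c≢d ∘ suc-injective)) ⟩
  g zero + (g (suc d) + sumFin (h ∘ suc))  ≡⟨ sym (+-assoc (g zero) _ _) ⟩
  (g zero + g (suc d)) + sumFin (h ∘ suc)  ≡⟨ cong (_+ sumFin (h ∘ suc)) (+-comm (g zero) _) ⟩
  (g (suc d) + g zero) + sumFin (h ∘ suc)  ≡⟨ +-assoc (g (suc d)) _ _ ⟩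
  g (suc d) + (g zero + sumFin (h ∘ suc))  ≡⟨ cong (λ z → g (suc d) + (z + sumFin (h ∘ suc))) (sym (h≗g zero λ ())) ⟩
  g (suc d) + sumFin h                     ∎
  where open ≡-Reasoning

sumFin-single : (d : Fin k) (g : Fin k → ℤ) → (∀ c → c ≢ d → g c ≡ 0ℤ) → sumFin g ≡ g d
sumFin-single {k = k} d g g≗0 = begin
  sumFin g                     ≡⟨ sumFin-split d g (λ _ → 0ℤ) refl (λ c c≢d → sym (g≗0 c c≢d)) ⟩
  g d + sumFin {k} (λ _ → 0ℤ)  ≡⟨ cong (g d +_) (sumFin-zero {k} λ _ → refl) ⟩
  g d + 0ℤ                     ≡⟨ +-identityʳ (g d) ⟩
  g d                          ∎
  where open ≡-Reasoning

IsDecomposition : SetFun n → (Fin n → Fin m) → Set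
IsDecomposition {n} g q = (A : Subset n) → g A ≡ sumFin (λ c → g (A ∩ cls q c))

Splits : SetFun n → Subset n → Subset n → Set
Splits {n} g C S = (A : Subset n) → A ⊆ C → g A ≡ g (A ─ S) + g (A ∩ S)

decomposition⇒splits : {g : SetFun n} {q : Fin n → Fin m} → g ⊥ ≡ 0ℤ → IsDecomposition g q →
  (C : Subset n) (d : Fin m) → Splits g C (cls q d)
decomposition⇒splits {g = g} {q} g⊥ decomposition C d A _ = begin
  g A                                                            ≡⟨ decomposition A ⟩
  sumFin (λ c → g (A ∩ cls q c))                                 ≡⟨ sumFin-split d _ _ outside-d≡0 outside-d≗ ⟩
  g (A ∩ cls q d) + sumFin (λ c → g ((A ─ cls q d) ∩ cls q c))  ≡⟨ cong (g (A ∩ cls q d) +_)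
                                                                       (sym (decomposition (A ─ cls q d))) ⟩
  g (A ∩ cls q d) + g (A ─ cls q d)                              ≡⟨ +-comm (g (A ∩ cls q d)) _ ⟩
  g (A ─ cls q d) + g (A ∩ cls q d)                              ∎
  where
  open ≡-Reasoning
  outside-d≡0 : g ((A ─ cls q d) ∩ cls q d) ≡ 0ℤ
  outside-d≡0 = trans (cong g (disjoint⇒∩≡⊥ (proj₂ ∘ x∈p─q⁻ A (cls q d)))) g⊥
  outside-d≗ : ∀ c → c ≢ d → g ((A ─ cls q d) ∩ cls q c) ≡ g (A ∩ cls q c)
  outside-d≗ c c≢d = cong g (─∩≡∩ A (cls-disjoint c≢d))

split⇒splits : {g : SetFun n} {C Z : Subset n} (f' f'' : SetFun n) → f' ⊥ ≡ 0ℤ → f'' ⊥ ≡ 0ℤ →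
  ((A : Subset n) → A ⊆ C → g A ≡ f' (A ∩ (C ─ Z)) + f'' (A ∩ Z)) → Splits g C Z
split⇒splits {g = g} {C} {Z} f' f'' f'⊥ f''⊥ split A A⊆C = begin
  g A                              ≡⟨ split A A⊆C ⟩
  f' (A ∩ (C ─ Z)) + f'' (A ∩ Z)   ≡⟨ cong (λ B → f' B + f'' (A ∩ Z)) (⊆⇒∩─≡─ Z A⊆C) ⟩
  f' (A ─ Z) + f'' (A ∩ Z)         ≡⟨ cong₂ _+_ (sym g-outside) (sym g-inside) ⟩
  g (A ─ Z) + g (A ∩ Z)            ∎
  where
  open ≡-Reasoning
  g-outside : g (A ─ Z) ≡ f' (A ─ Z)
  g-outside = begin
    g (A ─ Z)                                   ≡⟨ split (A ─ Z) (A⊆C ∘ p─q⊆p A Z) ⟩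
    f' ((A ─ Z) ∩ (C ─ Z)) + f'' ((A ─ Z) ∩ Z)  ≡⟨ cong₂ _+_
         (cong f' (⊆⇒∩≡ (─-monoˡ Z A⊆C)))
         (trans (cong f'' (disjoint⇒∩≡⊥ (proj₂ ∘ x∈p─q⁻ A Z))) f''⊥) ⟩
    f' (A ─ Z) + 0ℤ                             ≡⟨ +-identityʳ _ ⟩
    f' (A ─ Z)                                  ∎
  g-inside : g (A ∩ Z) ≡ f'' (A ∩ Z)
  g-inside = begin
    g (A ∩ Z)                                   ≡⟨ split (A ∩ Z) (A⊆C ∘ p∩q⊆p A Z) ⟩
    f' ((A ∩ Z) ∩ (C ─ Z)) + f'' ((A ∩ Z) ∩ Z)  ≡⟨ cong₂ _+_
         (trans (cong f' (disjoint⇒∩≡⊥ λ x∈A∩Z x∈C─Z → proj₂ (x∈p─q⁻ C Z x∈C─Z) (p∩q⊆q A Z x∈A∩Z))) f'⊥)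
         (cong f'' (⊆⇒∩≡ (p∩q⊆q A Z))) ⟩
    0ℤ + f'' (A ∩ Z)                            ≡⟨ +-identityˡ _ ⟩
    f'' (A ∩ Z)                                 ∎

indecOn⇒unsplit : {g : SetFun n} {C S : Subset n} → g ⊥ ≡ 0ℤ → IndecOn g C → Splits g C S →
  C ∩ S ≡ ⊥ ⊎ C ⊆ S
indecOn⇒unsplit {n = n} {g = g} {C} {S} g⊥ (_ , indecomposable) splits =
  Sum.map₂ (λ C∩S≡C → subst (_⊆ S) C∩S≡C (p∩q⊆q C S))
    (indecomposable (C ∩ S) (p∩q⊆p C S) g g g⊥ g⊥ self-split)
  where
  self-split : (A : Subset n) → A ⊆ C → g A ≡ g (A ∩ (C ─ C ∩ S)) + g (A ∩ (C ∩ S))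
  self-split A A⊆C = trans (splits A A⊆C) (cong₂ (λ B B' → g B + g B') outside inside)
    where
    outside : A ─ S ≡ A ∩ (C ─ C ∩ S)
    outside = sym (trans (⊆⇒∩─≡─ (C ∩ S) A⊆C) (⊆⇒─∩≡─ S A⊆C))
    inside : A ∩ S ≡ A ∩ (C ∩ S)
    inside = trans (cong (_∩ S) (sym (⊆⇒∩≡ A⊆C))) (∩-assoc A C S)

rigidOn⇒splits : {f : SetFun n} {Q S : Subset n} → RigidOn f Q → f Q ≡ f (Q ─ S) + f (Q ∩ S) →
  Splits f Q S
rigidOn⇒splits {f = f} {Q} {S} rigid additive A A⊆Q =
  trans (cong f (sym (─∪∩≡ A S)))
    (rigid (Q ─ S) (Q ∩ S) (p─q⊆p Q S) (p∩q⊆p Q S) disjoint (trans (cong f (─∪∩≡ Q S)) additive)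
           (A ─ S) (A ∩ S) (─-monoˡ S A⊆Q) (∩-monoˡ S A⊆Q))
  where
  disjoint : (Q ─ S) ∩ (Q ∩ S) ≡ ⊥
  disjoint = disjoint⇒∩≡⊥ λ x∈Q─S x∈Q∩S → proj₂ (x∈p─q⁻ Q S x∈Q─S) (p∩q⊆q Q S x∈Q∩S)

indecOn-cong : {g h : SetFun n} {C : Subset n} → (∀ A → A ⊆ C → g A ≡ h A) → IndecOn g C → IndecOn h C
indecOn-cong g≗h (nonempty , indecomposable) =
  nonempty , λ Z Z⊆C f' f'' f'⊥ f''⊥ split →
    indecomposable Z Z⊆C f' f'' f'⊥ f''⊥ λ A A⊆C → trans (g≗h A A⊆C) (split A A⊆C)

Refines : (Fin n → Fin m₁) → (Fin n → Fin m₂) → Set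
Refines {m₁ = m₁} {m₂} q₁ q₂ = Σ (Fin m₁ → Fin m₂) λ φ → ∀ x → q₂ x ≡ φ (q₁ x)

indecOn⇒constant : {g : SetFun n} {q : Fin n → Fin m} {C : Subset n} {x y : Fin n} →
  g ⊥ ≡ 0ℤ → IsDecomposition g q → IndecOn g C → x ∈ C → y ∈ C → q y ≡ q x
indecOn⇒constant {q = q} {C} {x} g⊥ decomposition indecomposable x∈C y∈C
  with indecOn⇒unsplit g⊥ indecomposable (decomposition⇒splits g⊥ decomposition C (q x))
... | inj₁ C∩cls≡⊥ = contradiction (subst (x ∈_) C∩cls≡⊥ (x∈p∩q⁺ (x∈C , ∈cls⁺ refl))) ∉⊥
... | inj₂ C⊆cls   = ∈cls⁻ (C⊆cls y∈C)

indecClasses⇒refines : {g : SetFun n} {q₁ : Fin n → Fin m₁} {q₂ : Fin n → Fin m₂} → g ⊥ ≡ 0ℤ →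
  SurjectiveMap q₁ → (∀ c → IndecOn g (cls q₁ c)) → IsDecomposition g q₂ → Refines q₁ q₂
indecClasses⇒refines {q₁ = q₁} {q₂} g⊥ surj indecomposable decomposition = φ , q₂≗φ∘q₁
  where
  representative : ∀ c → ∃ λ x → q₁ x ≡ c
  representative = surjective⇒strictlySurjective surj
  φ = q₂ ∘ proj₁ ∘ representative
  q₂≗φ∘q₁ : ∀ x → q₂ x ≡ φ (q₁ x)
  q₂≗φ∘q₁ x = indecOn⇒constant g⊥ decomposition (indecomposable (q₁ x))
    (∈cls⁺ (proj₂ (representative (q₁ x)))) (∈cls⁺ refl)

refines⇒surjective : {q₁ : Fin n → Fin m₁} {q₂ : Fin n → Fin m₂} → SurjectiveMap q₂ →
  ((φ , _) : Refines q₁ q₂) → StrictlySurjective _≡_ φ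
refines⇒surjective {q₁ = q₁} surj (φ , q₂≗φ∘q₁) c with surjective⇒strictlySurjective surj c
... | x , q₂x≡c = q₁ x , trans (sym (q₂≗φ∘q₁ x)) q₂x≡c

refines-both-ways⇒injective : {q₁ : Fin n → Fin m₁} {q₂ : Fin n → Fin m₂} → SurjectiveMap q₁ →
  ((φ , _) : Refines q₁ q₂) → Refines q₂ q₁ → Injective _≡_ _≡_ φ
refines-both-ways⇒injective {q₁ = q₁} surj (φ , q₂≗φ∘q₁) (ψ , q₁≗ψ∘q₂) {a} {b} φa≡φb =
  trans (sym (ψ∘φ≗id a)) (trans (cong ψ φa≡φb) (ψ∘φ≗id b))
  where
  ψ∘φ≗id : ∀ c → ψ (φ c) ≡ c
  ψ∘φ≗id c with surjective⇒strictlySurjective surj c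
  ... | x , refl = trans (cong ψ (sym (q₂≗φ∘q₁ x))) (sym (q₁≗ψ∘q₂ x))

icDecomp-unique : {g : SetFun n} {q₁ : Fin n → Fin m₁} {q₂ : Fin n → Fin m₂} → g ⊥ ≡ 0ℤ →
  IsICDecomp g q₁ → IsICDecomp g q₂ → m₁ ≡ m₂
icDecomp-unique g⊥ (surj₁ , decomposition₁ , indecomposable₁) (surj₂ , decomposition₂ , indecomposable₂) =
  cantor-schröder-bernstein (refines-both-ways⇒injective surj₁ q₁⊑q₂ q₂⊑q₁)
                            (refines-both-ways⇒injective surj₂ q₂⊑q₁ q₁⊑q₂)
  where
  q₁⊑q₂ = indecClasses⇒refines g⊥ surj₁ indecomposable₁ decomposition₂
  q₂⊑q₁ = indecClasses⇒refines g⊥ surj₂ indecomposable₂ decomposition₁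

surjective⇒injective : {φ : Fin k → Fin k} → StrictlySurjective _≡_ φ → Injective _≡_ _≡_ φ
surjective⇒injective {k = suc k} {φ} surj {a} {b} φa≡φb with a ≟ b
... | yes a≡b = a≡b
... | no a≢b  = contradiction (injective⇒≤ χ-injective) 1+n≰n
  where
  -- Since φ a ≡ φ b, every point has a φ-preimage other than b; punching b out of
  -- such preimages injects Fin (suc k) into Fin k.
  preimage-avoiding-b : ∀ c → ∃ λ x → b ≢ x × φ x ≡ c
  preimage-avoiding-b c with surj c
  ... | x , φx≡c with b ≟ x
  ...   | yes refl = a , (λ b≡a → a≢b (sym b≡a)) , trans φa≡φb φx≡c
  ...   | no b≢x   = x , b≢x , φx≡c
  χ : Fin (suc k) → Fin k
  χ c = punchOut (proj₁ (proj₂ (preimage-avoiding-b c)))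
  χ-injective : Injective _≡_ _≡_ χ
  χ-injective {c} {c'} χc≡χc' with preimage-avoiding-b c | preimage-avoiding-b c' | χc≡χc'
  ... | x , b≢x , refl | x' , b≢x' , refl | eq = cong φ (punchOut-injective b≢x b≢x' eq)

cls-refines-injective : {q₁ : Fin n → Fin m₁} {q₂ : Fin n → Fin m₂} ((φ , _) : Refines q₁ q₂) →
  Injective _≡_ _≡_ φ → (c : Fin m₁) → cls q₂ (φ c) ≡ cls q₁ c
cls-refines-injective {q₁ = q₁} {q₂} (φ , q₂≗φ∘q₁) φ-injective c = ⊆-antisym to from
  where
  to : cls q₂ (φ c) ⊆ cls q₁ c
  to {x} x∈ = ∈cls⁺ (φ-injective (trans (sym (q₂≗φ∘q₁ x)) (∈cls⁻ x∈)))
  from : cls q₁ c ⊆ cls q₂ (φ c)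
  from {x} x∈ = ∈cls⁺ (trans (q₂≗φ∘q₁ x) (cong φ (∈cls⁻ x∈)))

restr-⊥ : (f : SetFun n) (p : Fin n → Fin k) → f ⊥ ≡ 0ℤ → restr f p ⊥ ≡ 0ℤ
restr-⊥ f p f⊥ = sumFin-zero λ c → trans (cong f (∩-zeroˡ (cls p c))) f⊥

restr-⊆cls : (f : SetFun n) {p : Fin n → Fin k} {A : Subset n} {c : Fin k} → f ⊥ ≡ 0ℤ →
  A ⊆ cls p c → restr f p A ≡ f A
restr-⊆cls f {p} {A} {c} f⊥ A⊆c = begin
  sumFin (λ d → f (A ∩ cls p d)) ≡⟨ sumFin-single c _ (λ d d≢c → trans (cong f (outside-c d≢c)) f⊥) ⟩
  f (A ∩ cls p c)                ≡⟨ cong f (⊆⇒∩≡ A⊆c) ⟩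
  f A                            ∎
  where
  open ≡-Reasoning
  outside-c : ∀ {d} → d ≢ c → A ∩ cls p d ≡ ⊥
  outside-c d≢c = disjoint⇒∩≡⊥ λ x∈A → cls-disjoint (d≢c ∘ sym) (A⊆c x∈A)

restr-decomposition : (f : SetFun n) (p : Fin n → Fin k) → f ⊥ ≡ 0ℤ → IsDecomposition (restr f p) p
restr-decomposition f p f⊥ A = sumFin-cong λ c → sym (restr-⊆cls f f⊥ (p∩q⊆q A (cls p c)))

inEW⇒indecClasses : {f : SetFun n} {p : Fin n → Fin k} → f ⊥ ≡ 0ℤ → InEW f p → ∀ c → IndecOn f (cls p c)
inEW⇒indecClasses {f = f} {p} f⊥ (surj , q , surjq , _ , indecomposable) c =
  indecOn-cong (λ _ → restr-⊆cls f f⊥) (subst (IndecOn (restr f p)) class≡class (indecomposable c'))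
  where
  q⊑p : Refines q p
  q⊑p = indecClasses⇒refines (restr-⊥ f p f⊥) surjq indecomposable (restr-decomposition f p f⊥)
  φ-surjective = refines⇒surjective surj q⊑p
  c' = proj₁ (φ-surjective c)
  class≡class : cls q c' ≡ cls p c
  class≡class = trans (sym (cls-refines-injective q⊑p (surjective⇒injective φ-surjective) c'))
                      (cong (cls p) (proj₂ (φ-surjective c)))

quot-⊥ : (f : SetFun n) (p : Fin n → Fin k) → f ⊥ ≡ 0ℤ → quot f p ⊥ ≡ 0ℤ
quot-⊥ f p f⊥ = trans (cong f (preimage-⊥ p)) f⊥

-- A splitting of f/~ on R pulls back to a subset V of C = ϖ⁻¹(R) on which f is additive
-- at the top, f C = f (C ∖ V) + f (C ∩ V); rigidity spreads this to all subsets of C.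
quot-indecOn : {f : SetFun n} {p : Fin n → Fin k} {R : Subset k} → f ⊥ ≡ 0ℤ → SurjectiveMap p →
  RigidOn f (preimage p R) → IndecOn f (preimage p R) → IndecOn (quot f p) R
quot-indecOn {k = k} {f = f} {p} {R} f⊥ surj rigid indecomposable@((x , x∈C) , _) =
  (p x , ∈preimage⁻ p R x∈C) , unsplit
  where
  C = preimage p R
  unsplit : (Z : Subset k) → Z ⊆ R → (f' f'' : SetFun k) → f' ⊥ ≡ 0ℤ → f'' ⊥ ≡ 0ℤ →
    ((B : Subset k) → B ⊆ R → quot f p B ≡ f' (B ∩ (R ─ Z)) + f'' (B ∩ Z)) → Z ≡ ⊥ ⊎ Z ≡ R
  unsplit Z Z⊆R f' f'' f'⊥ f''⊥ split =
    Sum.map C∩V≡⊥⇒Z≡⊥ C⊆V⇒Z≡R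
      (indecOn⇒unsplit f⊥ indecomposable (rigidOn⇒splits rigid additive))
    where
    V = preimage p Z
    additive : f C ≡ f (C ─ V) + f (C ∩ V)
    additive = trans (split⇒splits f' f'' f'⊥ f''⊥ split R ⊆-refl)
                     (cong₂ (λ A B → f A + f B) (preimage-─ p R Z) (preimage-∩ p R Z))
    C∩V≡⊥⇒Z≡⊥ : C ∩ V ≡ ⊥ → Z ≡ ⊥
    C∩V≡⊥⇒Z≡⊥ C∩V≡⊥ = preimage-injective surj (begin
      V              ≡⟨ sym (⊆⇒∩≡ (preimage-mono p Z⊆R)) ⟩
      V ∩ C          ≡⟨ ∩-comm V C ⟩
      C ∩ V          ≡⟨ C∩V≡⊥ ⟩
      ⊥              ≡⟨ sym (preimage-⊥ p) ⟩
      preimage p ⊥   ∎)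
      where open ≡-Reasoning
    C⊆V⇒Z≡R : C ⊆ V → Z ≡ R
    C⊆V⇒Z≡R C⊆V = ⊆-antisym Z⊆R (preimage-reflects-⊆ surj C⊆V)

quot-isICDecomp : {f : SetFun n} {p : Fin n → Fin k} {q : Fin n → Fin m} → f ⊥ ≡ 0ℤ →
  SurjectiveMap p → IsICDecomp f q → (∀ d → RigidOn f (cls q d)) →
  ((r , _) : Refines p q) → IsICDecomp (quot f p) r
quot-isICDecomp {f = f} {p} {q} f⊥ surj (surjq , decomposition , indecomposable) rigid (r , q≗r∘p) =
  strictlySurjective⇒surjective (refines⇒surjective surjq (r , q≗r∘p)) ,
  (λ B → trans (decomposition (preimage p B)) (sumFin-cong λ d → cong f (pullback B d))) ,
  λ d → quot-indecOn f⊥ surj (subst (RigidOn f) (sym (cls≡ d)) (rigid d))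
                              (subst (IndecOn f) (sym (cls≡ d)) (indecomposable d))
  where
  cls≡ : ∀ d → preimage p (cls r d) ≡ cls q d
  cls≡ = preimage-cls p r q≗r∘p
  pullback : ∀ B d → preimage p B ∩ cls q d ≡ preimage p (B ∩ cls r d)
  pullback B d = trans (cong (preimage p B ∩_) (sym (cls≡ d))) (sym (preimage-∩ p B (cls r d)))

lemma4p13 : (n : ℕ) (f : SetFun n) → f ⊥ ≡ 0ℤ → Rigid f →
    (k : ℕ) (p : Fin n → Fin k) → InEW f p ⇔ InES f p
lemma4p13 n f f⊥ (m , q , icq@(_ , decomposition , _) , rigid) k p = mk⇔ (λ ew → ew , ic-quot≡ic ew) proj₁
  where
  ic-quot≡ic : InEW f p → (m₁ m₂ : ℕ) → HasIC (quot f p) m₁ → HasIC f m₂ → m₁ ≡ m₂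
  ic-quot≡ic ew@(surj , _) _ _ (r₁ , icr₁) (q₂ , icq₂) =
    trans (icDecomp-unique (quot-⊥ f p f⊥) icr₁ icr) (icDecomp-unique f⊥ icq icq₂)
    where
    p⊑q : Refines p q
    p⊑q = indecClasses⇒refines f⊥ surj (inEW⇒indecClasses f⊥ ew) decomposition
    icr : IsICDecomp (quot f p) (proj₁ p⊑q)
    icr = quot-isICDecomp f⊥ surj icq rigid p⊑q
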